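{- Let $\phi$ be an $\mathrm{RML}^{\exists_r}$ formula. If there exists a complete accepting tableau branch containing $(1,1)\ \phi$ (i.e., starting from $(1,1)\ \phi$), then $\phi$ is satisfiable.
   Context: Kripke structures $\mathcal{M}=(W,R,V)$: $W$ states, $R\subseteq W\times W$, $V$ assigns sets of propositional variables to states. A non-empty $\mathcal{R}\subseteq W\times W'$ is a refinement mapping from $\mathcal{M}$ to $\mathcal{M}'=(W',R',V')$ if $V(s)=V'(s')$ for all $(s,s')\in\mathcal{R}$, and whenever $(s,s')\in\mathcal{R}$ and $s'R't'$ there is $t$ with $sRt$ and $(t,t')\in\mathcal{R}$; then for $(s,s')\in\mathcal{R}$, $(\mathcal{M}',s')$ is a refinement of $(\mathcal{M},s)$. $\mathrm{RML}^{\exists_r}$ formulas: $\phi::=p\mid\neg p\mid\phi\wedge\phi\mid\phi\vee\phi\mid\Diamond\phi\mid\Box\phi\mid\exists_r\phi$, with usual Kripke semantics and $\mathcal{M},s\models\exists_r\psi$ iff some refinement $(\mathcal{M}',s')$ of $(\mathcal{M},s)$ satisfies $\mathcal{M}',s'\models\psi$. A literal is $p$ or $\neg p$. $\phi$ is satisfiable if $\mathcal{M},s\models\phi$ for some $\mathcal{M},s$. Tableau: prefixes are nonempty finite strings over $\mathbb{N}$, with $\mu.\nu$ denoting concatenation ($\nu$ may be empty when written $\mu.\nu$ with $\nu\in\mathbb{N}^*$). A prefixed formula is $(\mu,\sigma)\ \psi$ with prefixes $\mu,\sigma$ and formula $\psi$. A tableau branch starting from $(1,1)\ \phi$ is a set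 of prefixed formulas obtained from $\{(1,1)\ \phi\}$ by repeatedly applying the rules: ($\wedge$) from $(\mu,\sigma)\ \psi_1\wedge\psi_2$ add $(\mu,\sigma)\ \psi_1$ and $(\mu,\sigma)\ \psi_2$; ($\vee$) from $(\mu,\sigma)\ \psi_1\vee\psi_2$ add (by a nondeterministic choice) one of $(\mu,\sigma)\ \psi_1$ or $(\mu,\sigma)\ \psi_2$; ($L$) from $(\mu.\nu,\sigma)\ l$ with $l$ a literal add $(\mu,\sigma)\ l$; ($\Diamond$) from $(\mu,\sigma)\ \Diamond\psi$ add $(\mu,\sigma.i)\ \psi$ where $\sigma.i$ has not appeared in the branch; ($\exists_r$) from $(\mu,\sigma)\ \exists_r\psi$ add $(\mu.m,\sigma)\ \psi$ where $\mu.m$ has not appeared in the branch; ($\Box$) from $(\mu,\sigma)\ \Box\psi$ add $(\mu,\sigma.i)\ \psi$ whenever some prefixed formula with prefix $(\mu.\nu,\sigma.i)$, $\nu\in\mathbb{N}^*$, has already appeared in the branch. A branch is complete if all rules have been applied as much as possible. A complete branch is rejecting if it contains $(\mu,\sigma)\ p$ and $(\mu,\sigma)\ \neg p$ for some $\mu,\sigma,p$; otherwise it is accepting. -}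

module Defs where

open import Level using (Lift; lift) renaming (suc to lsuc; zero to lzero)
open import Data.Nat using (ℕ)
open import Data.Bool using (Bool; true)
open import Data.List using (List; []; _∷_)
open import Data.List.NonEmpty using (List⁺; _⁺++_) renaming (_∷_ to _∷⁺_)
open import Data.List.Membership.Propositional using (_∈_; _∉_)
open import Data.Product using (Σ; _×_; _,_; ∃)
open import Data.Sum using (_⊎_)
open import Relation.Binary.PropositionalEquality using (_≡_)
open import Relation.Nullary using (¬_)
open import Relation.Binary.Construct.Closure.ReflexiveTransitive using (Star)

record Kripke : Set₁ where
  field
    W : Set
    R : W → W → Set
    V : W → ℕ → Bool
open Kripke public

record IsRefinementMapping (M M' : Kripke) (ℛ : W M → W M' → Set) : Set where
  field
    nonempty : Σ (W M) λ s → Σ (W M') λ s' → ℛ s s'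
    atoms    : ∀ s s' → ℛ s s' → ∀ p → V M s p ≡ V M' s' p
    back     : ∀ s s' t' → ℛ s s' → R M' s' t' →
               Σ (W M) λ t → R M s t × ℛ t t'

-- RML^{∃r} formulas (negation normal form)

data Form : Set where
  var  : ℕ → Form
  neg  : ℕ → Form
  _∧_  : Form → Form → Form
  _∨_  : Form → Form → Form
  ◇_   : Form → Form
  □_   : Form → Form
  ∃r_  : Form → Form

data IsLiteral : Form → Set where
  lit-var : ∀ p → IsLiteral (var p)
  lit-neg : ∀ p → IsLiteral (neg p)

_,_⊨_ : (M : Kripke) → W M → Form → Set₁
M , s ⊨ var p    = Lift (lsuc lzero) (V M s p ≡ true)
M , s ⊨ neg p    = Lift (lsuc lzero) (¬ (V M s p ≡ true))
M , s ⊨ (φ ∧ ψ)  = (M , s ⊨ φ) × (M , s ⊨ ψ)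
M , s ⊨ (φ ∨ ψ)  = (M , s ⊨ φ) ⊎ (M , s ⊨ ψ)
M , s ⊨ (◇ φ)    = Σ (W M) λ t → Lift (lsuc lzero) (R M s t) × (M , t ⊨ φ)
M , s ⊨ (□ φ)    = ∀ t → R M s t → M , t ⊨ φ
M , s ⊨ (∃r φ)   =
  Σ Kripke λ M' → Σ (W M') λ s' → Σ (W M → W M' → Set) λ ℛ →
    IsRefinementMapping M M' ℛ × Lift (lsuc lzero) (ℛ s s') × (M' , s' ⊨ φ)

Satisfiable : Form → Set₁
Satisfiable φ = Σ Kripke λ M → Σ (W M) λ s → M , s ⊨ φ

Prefix : Set
Prefix = List⁺ ℕ

_·_ : Prefix → ℕ → Prefix
μ · i = μ ⁺++ (i ∷ [])

one : Prefix
one = 1 ∷⁺ []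

record PFormula : Set where
  constructor ⟨_,_⟩_
  field
    fst : Prefix
    snd : Prefix
    frm : Form

Branch : Set
Branch = List PFormula

data Step (B : Branch) : Branch → Set where
  ∧-rule  : ∀ μ σ ψ₁ ψ₂ → (⟨ μ , σ ⟩ (ψ₁ ∧ ψ₂)) ∈ B →
            Step B ((⟨ μ , σ ⟩ ψ₁) ∷ (⟨ μ , σ ⟩ ψ₂) ∷ B)
  ∨-rule₁ : ∀ μ σ ψ₁ ψ₂ → (⟨ μ , σ ⟩ (ψ₁ ∨ ψ₂)) ∈ B →
            Step B ((⟨ μ , σ ⟩ ψ₁) ∷ B)
  ∨-rule₂ : ∀ μ σ ψ₁ ψ₂ → (⟨ μ , σ ⟩ (ψ₁ ∨ ψ₂)) ∈ B →
            Step B ((⟨ μ , σ ⟩ ψ₂) ∷ B)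
  L-rule  : ∀ μ ν σ l → IsLiteral l → (⟨ μ ⁺++ ν , σ ⟩ l) ∈ B →
            Step B ((⟨ μ , σ ⟩ l) ∷ B)
  ◇-rule  : ∀ μ σ ψ i → (⟨ μ , σ ⟩ (◇ ψ)) ∈ B →
            (∀ μ' ψ' → (⟨ μ' , σ · i ⟩ ψ') ∉ B) →
            Step B ((⟨ μ , σ · i ⟩ ψ) ∷ B)
  ∃r-rule : ∀ μ σ ψ m → (⟨ μ , σ ⟩ (∃r ψ)) ∈ B →
            (∀ σ' ψ' → (⟨ μ · m , σ' ⟩ ψ') ∉ B) →
            Step B ((⟨ μ · m , σ ⟩ ψ) ∷ B)
  □-rule  : ∀ μ σ ψ ν i χ → (⟨ μ , σ ⟩ (□ ψ)) ∈ B →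
            (⟨ μ ⁺++ ν , σ · i ⟩ χ) ∈ B →
            Step B ((⟨ μ , σ · i ⟩ ψ) ∷ B)

IsBranchFrom : Form → Branch → Set
IsBranchFrom φ B = Star Step ((⟨ one , one ⟩ φ) ∷ []) B

record Complete (B : Branch) : Set where
  field
    ∧-sat  : ∀ μ σ ψ₁ ψ₂ → (⟨ μ , σ ⟩ (ψ₁ ∧ ψ₂)) ∈ B →
             (⟨ μ , σ ⟩ ψ₁) ∈ B × (⟨ μ , σ ⟩ ψ₂) ∈ B
    ∨-sat  : ∀ μ σ ψ₁ ψ₂ → (⟨ μ , σ ⟩ (ψ₁ ∨ ψ₂)) ∈ B →
             (⟨ μ , σ ⟩ ψ₁) ∈ B ⊎ (⟨ μ , σ ⟩ ψ₂) ∈ B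
    L-sat  : ∀ μ ν σ l → IsLiteral l → (⟨ μ ⁺++ ν , σ ⟩ l) ∈ B →
             (⟨ μ , σ ⟩ l) ∈ B
    ◇-sat  : ∀ μ σ ψ → (⟨ μ , σ ⟩ (◇ ψ)) ∈ B →
             ∃ λ i → (⟨ μ , σ · i ⟩ ψ) ∈ B
    ∃r-sat : ∀ μ σ ψ → (⟨ μ , σ ⟩ (∃r ψ)) ∈ B →
             ∃ λ m → (⟨ μ · m , σ ⟩ ψ) ∈ B
    □-sat  : ∀ μ σ ψ ν i χ → (⟨ μ , σ ⟩ (□ ψ)) ∈ B →
             (⟨ μ ⁺++ ν , σ · i ⟩ χ) ∈ B →
             (⟨ μ , σ · i ⟩ ψ) ∈ B

Rejecting : Branch → Set
Rejecting B = ∃ λ μ → ∃ λ σ → ∃ λ p →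
  (⟨ μ , σ ⟩ var p) ∈ B × (⟨ μ , σ ⟩ neg p) ∈ B

Accepting : Branch → Set
Accepting B = ¬ Rejecting B

-- Read a model off the saturated branch. For each first prefix μ take the Kripke structure whose
-- worlds are second prefixes, with σ → σ.i whenever some formula with prefix (μ.ν, σ.i) lies on
-- the branch, and where p holds at σ iff ([head μ], σ) p lies on the branch; the L-rule pushes
-- every literal down to such a one-letter prefix. The structure for μ.m then has fewer edges than
-- the one for μ and the same valuation, so the identity on prefixes is a refinement mapping, and
-- an induction on formulas shows that every (μ, σ) ψ on the branch holds at σ in the structure
-- for μ, acceptance ruling out a clash for ¬p.
module Submission where

open import Defs
open import Level using (lift)
open import Data.Nat using (ℕ) renaming (_≟_ to _≟ℕ_)
open import Data.List using (List; []; _∷_)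
open import Data.List.Properties using (++-identityʳ; ++-assoc; ≡-dec)
open import Data.List.NonEmpty using (List⁺; _⁺++_; head; [_]) renaming (_∷_ to _∷⁺_)
open import Data.List.Membership.Propositional using (_∈_)
open import Data.List.Relation.Binary.Subset.Propositional using (_⊆_)
open import Data.List.Relation.Unary.Any using (here; there; any?)
open import Data.Product using (Σ; _×_; _,_)
open import Data.Sum using (inj₁; inj₂)
open import Function using (id; _∘_)
open import Relation.Binary.Definitions using (DecidableEquality)
open import Relation.Binary.PropositionalEquality using (_≡_; refl; sym; cong; subst)
open import Relation.Nullary using (Dec; yes; no; does; _×-dec_)
open import Relation.Nullary.Decidable using (map′; dec-true)
open import Relation.Binary.Construct.Closure.ReflexiveTransitive using (Star; ε; _◅_)

⁺++-identityʳ : ∀ {A : Set} (xs : List⁺ A) → xs ⁺++ [] ≡ xs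
⁺++-identityʳ (x ∷⁺ xs) = cong (x ∷⁺_) (++-identityʳ xs)

·-⁺++ : ∀ μ m ν → (μ · m) ⁺++ ν ≡ μ ⁺++ (m ∷ ν)
·-⁺++ (x ∷⁺ xs) m ν = cong (x ∷⁺_) (++-assoc xs (m ∷ []) ν)

_≟⁺_ : DecidableEquality Prefix
(x ∷⁺ xs) ≟⁺ (y ∷⁺ ys) =
  map′ (λ { (refl , refl) → refl }) (λ { refl → refl , refl }) (x ≟ℕ y ×-dec ≡-dec _≟ℕ_ xs ys)

var-≟ : ∀ p ψ → Dec (var p ≡ ψ)
var-≟ p (var q) = map′ (cong var) (λ { refl → refl }) (p ≟ℕ q)
var-≟ p (neg _) = no λ ()
var-≟ p (_ ∧ _) = no λ ()
var-≟ p (_ ∨ _) = no λ ()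
var-≟ p (◇ _)   = no λ ()
var-≟ p (□ _)   = no λ ()
var-≟ p (∃r _)  = no λ ()

var-pf-≟ : ∀ μ σ p x → Dec (⟨ μ , σ ⟩ var p ≡ x)
var-pf-≟ μ σ p (⟨ μ' , σ' ⟩ ψ) with μ ≟⁺ μ' | σ ≟⁺ σ' | var-≟ p ψ
... | yes refl | yes refl | yes refl = yes refl
... | no μ≢μ'  | _        | _        = no λ { refl → μ≢μ' refl }
... | _        | no σ≢σ'  | _        = no λ { refl → σ≢σ' refl }
... | _        | _        | no p≢ψ   = no λ { refl → p≢ψ refl }

step-⊆ : ∀ {B B'} → Step B B' → B ⊆ B'
step-⊆ (∧-rule _ _ _ _ _)       = there ∘ there
step-⊆ (∨-rule₁ _ _ _ _ _)      = there
step-⊆ (∨-rule₂ _ _ _ _ _)      = there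
step-⊆ (L-rule _ _ _ _ _ _)     = there
step-⊆ (◇-rule _ _ _ _ _ _)     = there
step-⊆ (∃r-rule _ _ _ _ _ _)    = there
step-⊆ (□-rule _ _ _ _ _ _ _ _) = there

steps-⊆ : ∀ {B B'} → Star Step B B' → B ⊆ B'
steps-⊆ ε        = id
steps-⊆ (s ◅ ss) = steps-⊆ ss ∘ step-⊆ s

module CanonicalModel (B : Branch) (complete : Complete B) (accepting : Accepting B) where
  open Complete complete

  var-∈? : ∀ μ σ p → Dec ((⟨ μ , σ ⟩ var p) ∈ B)
  var-∈? μ σ p = any? (var-pf-≟ μ σ p) B

  model : Prefix → Kripke
  W (model μ)     = Prefix
  R (model μ) σ τ = Σ ℕ λ i → τ ≡ σ · i × Σ (List ℕ) λ ν → Σ Form λ χ → (⟨ μ ⁺++ ν , τ ⟩ χ) ∈ B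
  V (model μ) σ p = does (var-∈? [ head μ ] σ p)

  identity-refines : ∀ μ m → IsRefinementMapping (model μ) (model (μ · m)) _≡_
  identity-refines μ m = record
    { nonempty = one , one , refl
    ; atoms    = λ { s .s refl p → refl }
    ; back     = λ { s .s τ refl (i , τ≡s·i , ν , χ , χ∈B) →
        τ , (i , τ≡s·i , m ∷ ν , χ , subst (λ κ → (⟨ κ , τ ⟩ χ) ∈ B) (·-⁺++ μ m ν) χ∈B) , refl }
    }

  ∈⇒⊨ : ∀ ψ μ σ → (⟨ μ , σ ⟩ ψ) ∈ B → model μ , σ ⊨ ψ
  ∈⇒⊨ (var p) (h ∷⁺ ν) σ p∈B =
    lift (dec-true (var-∈? [ h ] σ p) (L-sat [ h ] ν σ (var p) (lit-var p) p∈B))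
  ∈⇒⊨ (neg p) (h ∷⁺ ν) σ ¬p∈B with var-∈? [ h ] σ p
  ... | yes p∈B =
    lift λ _ → accepting ([ h ] , σ , p , p∈B , L-sat [ h ] ν σ (neg p) (lit-neg p) ¬p∈B)
  ... | no _    = lift λ ()
  ∈⇒⊨ (ψ₁ ∧ ψ₂) μ σ ∧∈B with ∧-sat μ σ ψ₁ ψ₂ ∧∈B
  ... | ψ₁∈B , ψ₂∈B = ∈⇒⊨ ψ₁ μ σ ψ₁∈B , ∈⇒⊨ ψ₂ μ σ ψ₂∈B
  ∈⇒⊨ (ψ₁ ∨ ψ₂) μ σ ∨∈B with ∨-sat μ σ ψ₁ ψ₂ ∨∈B
  ... | inj₁ ψ₁∈B = inj₁ (∈⇒⊨ ψ₁ μ σ ψ₁∈B)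
  ... | inj₂ ψ₂∈B = inj₂ (∈⇒⊨ ψ₂ μ σ ψ₂∈B)
  ∈⇒⊨ (◇ ψ) μ σ ◇∈B with ◇-sat μ σ ψ ◇∈B
  ... | i , ψ∈B =
    σ · i , lift (i , refl , [] , ψ , subst (λ κ → (⟨ κ , σ · i ⟩ ψ) ∈ B) (sym (⁺++-identityʳ μ)) ψ∈B)
          , ∈⇒⊨ ψ μ (σ · i) ψ∈B
  ∈⇒⊨ (□ ψ) μ σ □∈B .(σ · i) (i , refl , ν , χ , χ∈B) =
    ∈⇒⊨ ψ μ (σ · i) (□-sat μ σ ψ ν i χ □∈B χ∈B)
  ∈⇒⊨ (∃r ψ) μ σ ∃∈B with ∃r-sat μ σ ψ ∃∈B
  ... | m , ψ∈B = model (μ · m) , σ , _≡_ , identity-refines μ m , lift refl , ∈⇒⊨ ψ (μ · m) σ ψ∈B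

lemma2 : ∀ (φ : Form) (B : Branch) → IsBranchFrom φ B → Complete B → Accepting B →
    Satisfiable φ
lemma2 φ B steps complete accepting =
  model one , one , ∈⇒⊨ φ one one (steps-⊆ steps (here refl))
  where open CanonicalModel B complete accepting
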